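{- Let $G$ be a finite simple graph with $m$ edges and let $M\neq\emptyset$ be a matching of $G$. Then $d(M)=m$ if and only if every edge of $M$ is a bond or a pendant edge of $G$.
   Context: A matching of $G=(V,E)$ is a set of pairwise disjoint edges; $\chi_F\in\mathbb{R}^E$ is the incidence vector of $F\subseteq E$. The matching polytope $\mathcal{M}(G)$ is the convex hull of the incidence vectors of all matchings of $G$; its vertices are exactly these vectors. The skeleton $\mathcal{G}(\mathcal{M}(G))$ is the graph whose vertices and edges are the vertices and edges (1-dimensional faces) of $\mathcal{M}(G)$, and $d(M)$ denotes the degree of $\chi_M$ in it. A pendant edge of $G$ is an edge having an endpoint of degree $1$. An edge $uv$ of $G$ is a bond if $d(u)=d(v)=2$ and $|N(u)\cap N(v)|=1$, where $d(\cdot)$ is vertex degree and $N(\cdot)$ the neighborhood in $G$. -}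

module Defs where

open import Data.Nat as ℕ using (ℕ)
open import Data.Integer as ℤ using (ℤ; 0ℤ)
open import Data.Fin using (Fin; _≟_)
open import Data.Fin.Subset using (Subset; _∈_)
open import Data.Fin.Properties using (any?)
open import Data.Vec using (lookup)
open import Data.Bool using (if_then_else_)
open import Data.List using (List; length; filter; map; foldr; allFin)
open import Data.List.Relation.Unary.All using (All)
open import Data.List.Relation.Unary.Unique.Propositional using (Unique)
open import Data.List.Membership.Propositional renaming (_∈_ to _∈ₗ_)
open import Data.Product using (Σ; ∃; _×_; _,_; proj₁; proj₂)
open import Data.Sum using (_⊎_)
open import Relation.Binary.PropositionalEquality using (_≡_; _≢_)
open import Relation.Nullary using (¬_; Dec)
open import Relation.Nullary.Decidable using (_⊎-dec_; _×-dec_)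

SameEdge : {n : ℕ} → Fin n × Fin n → Fin n × Fin n → Set
SameEdge (a , b) (c , d) = (a ≡ c × b ≡ d) ⊎ (a ≡ d × b ≡ c)

sameEdge? : {n : ℕ} (p q : Fin n × Fin n) → Dec (SameEdge p q)
sameEdge? (a , b) (c , d) = ((a ≟ c) ×-dec (b ≟ d)) ⊎-dec ((a ≟ d) ×-dec (b ≟ c))

record Graph : Set where
  field
    n      : ℕ
    m      : ℕ
    ends   : Fin m → Fin n × Fin n
    noLoop : ∀ i → proj₁ (ends i) ≢ proj₂ (ends i)
    simple : ∀ i j → SameEdge (ends i) (ends j) → i ≡ j

module _ (G : Graph) where
  open Graph G

  Incident : Fin n → Fin m → Set
  Incident v i = v ≡ proj₁ (ends i) ⊎ v ≡ proj₂ (ends i)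

  incident? : ∀ v i → Dec (Incident v i)
  incident? v i = (v ≟ proj₁ (ends i)) ⊎-dec (v ≟ proj₂ (ends i))

  vdeg : Fin n → ℕ
  vdeg v = length (filter (incident? v) (allFin m))

  AdjV : Fin n → Fin n → Set
  AdjV u w = ∃ λ i → SameEdge (ends i) (u , w)

  adjV? : ∀ u w → Dec (AdjV u w)
  adjV? u w = any? (λ i → sameEdge? (ends i) (u , w))

  commonNbrs : Fin n → Fin n → ℕ
  commonNbrs u v = length (filter (λ w → adjV? u w ×-dec adjV? v w) (allFin n))

  Pendant : Fin m → Set
  Pendant i = vdeg (proj₁ (ends i)) ≡ 1 ⊎ vdeg (proj₂ (ends i)) ≡ 1

  Bond : Fin m → Set
  Bond i = vdeg (proj₁ (ends i)) ≡ 2 × vdeg (proj₂ (ends i)) ≡ 2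
           × commonNbrs (proj₁ (ends i)) (proj₂ (ends i)) ≡ 1

  IsMatching : Subset m → Set
  IsMatching F = ∀ i j → i ∈ F → j ∈ F → i ≢ j →
                 ¬ (∃ λ v → Incident v i × Incident v j)

  -- c · χ_F  for an (integer) linear functional c on ℝ^E
  weight : (Fin m → ℤ) → Subset m → ℤ
  weight c F = foldr ℤ._+_ 0ℤ (map (λ i → if lookup F i then c i else 0ℤ) (allFin m))

  -- χ_M χ_N is an edge (1-dimensional face) of the matching polytope:
  -- some linear functional is maximised over the vertices exactly at χ_M and χ_N.
  SkelAdj : Subset m → Subset m → Set
  SkelAdj M N = M ≢ N × ∃ λ (c : Fin m → ℤ) →
      weight c M ≡ weight c N ×
      (∀ L → IsMatching L → L ≢ M → L ≢ N → weight c L ℤ.< weight c M)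

  -- d(M) = k : χ_M has exactly k neighbours in the skeleton
  HasSkelDegree : Subset m → ℕ → Set
  HasSkelDegree M k = ∃ λ (Ns : List (Subset m)) →
      length Ns ≡ k × Unique Ns ×
      All (λ N → IsMatching N × SkelAdj M N) Ns ×
      (∀ N → IsMatching N → SkelAdj M N → N ∈ₗ Ns)

-- If N is a matching and the edges of M Δ N are connected under "i ∈ M ∖ N meets k ∈ N ∖ M",
-- then χ_M χ_N is an edge of the matching polytope: the integer functional rewarding the edges on
-- which M and N agree and every such alternating pair is maximised exactly at M and N. Toggling an
-- edge j (adding it and evicting the edges of M it meets, or removing it) therefore yields m
-- distinct neighbours of M.
-- If every edge of M has a clique neighbourhood in the line graph, there are no others: for a
-- neighbour N and j ∈ N ∖ M (or j ∈ M ∖ N when N ⊆ M), recombining χ_M and χ_N along the edges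
-- meeting j gives two matchings with the same sum, so one of them is N, and it is the toggle of j.
-- Otherwise some e ∈ M meets two disjoint edges f and g, and toggling both gives an (m+1)-st
-- neighbour. Finally, an edge has a clique neighbourhood in the line graph exactly when it is a
-- bond or a pendant edge.

module Submission where

open import Defs
open import Data.Fin.Subset using (Subset; _∈_)
open import Data.Product using (∃)
open import Data.Sum using (_⊎_)
open import Function.Bundles using (_⇔_)

open import Data.Bool as Bool using (Bool; true; false; not; _∧_; _xor_; if_then_else_)
open import Data.Bool.Properties using (¬-not; not-¬; not-involutive; ∧-zeroʳ; ∧-identityʳ)
open import Data.Empty using (⊥)
open import Data.Fin as Fin using (Fin; _≟_)
open import Data.Fin.Properties using (any?)
open import Data.Integer as ℤ using (ℤ; 0ℤ; 1ℤ; -1ℤ; _+_; _*_; _≤_; _<_; +≤+; -≤+)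
import Data.Integer.Properties as ℤP
open import Algebra.Properties.Semiring.Sum ℤP.+-*-semiring
  using (sum; ∑-distrib-+; ∑-comm; *-distribˡ-sum; sum-cong-≗)
open import Data.List as List using (List; []; _∷_; length; filter; foldr; allFin)
import Data.List.Properties as ListP
open import Data.List.Membership.Propositional using (_∉_) renaming (_∈_ to _∈ₗ_)
open import Data.List.Membership.Propositional.Properties
  using (∈-filter⁺; ∈-filter⁻; ∈-allFin; ∈-tabulate⁺; ∈-tabulate⁻)
open import Data.List.Relation.Binary.Subset.Propositional using (_⊆_)
open import Data.List.Relation.Unary.All as All using (All; []; _∷_)
import Data.List.Relation.Unary.All.Properties as All
open import Data.List.Relation.Unary.AllPairs using ([]; _∷_)
open import Data.List.Relation.Unary.Any using (here; there; _─_; index)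
open import Data.List.Relation.Unary.Unique.Propositional using (Unique)
import Data.List.Relation.Unary.Unique.Propositional.Properties as Unique
open import Data.Nat as ℕ using (ℕ; zero; suc; z≤n; s≤s)
import Data.Nat.Properties as ℕP
open import Data.Product using (∃₂; _×_; _,_; proj₁; proj₂)
open import Data.Sum using (inj₁; inj₂; [_,_]′)
open import Data.Vec as Vec using (lookup; tabulate)
import Data.Vec.Properties as VecP
open import Function using (_∘_; id)
open import Function.Bundles using (mk⇔)
open import Level using (0ℓ)
open import Relation.Binary.Construct.Closure.Equivalence using (EqClosure; gfold)
open import Relation.Binary.Construct.Closure.ReflexiveTransitive using (ε; _◅_)
open import Relation.Binary.Construct.Closure.Symmetric using (fwd; bwd)
open import Relation.Binary.PropositionalEquality
open import Relation.Nullary using (¬_; Dec; yes; no; does; ¬?; contradiction)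
open import Relation.Nullary.Decidable using (_×-dec_; dec-true; dec-false; decidable-stable)
open import Relation.Unary using (Pred; Decidable)

module _ {A : Set} where

  ∈-─ : ∀ {x y : A} {ys} (x∈ys : x ∈ₗ ys) → y ∈ₗ ys → y ≢ x → y ∈ₗ (ys ─ x∈ys)
  ∈-─ (here refl) (here refl) y≢x = contradiction refl y≢x
  ∈-─ (here refl) (there y∈ys) _  = y∈ys
  ∈-─ (there _)   (here refl) _   = here refl
  ∈-─ (there x∈ys) (there y∈ys) y≢x = there (∈-─ x∈ys y∈ys y≢x)

  unique-⊆⇒length-≤ : {xs ys : List A} → Unique xs → xs ⊆ ys → length xs ℕ.≤ length ys
  unique-⊆⇒length-≤ {[]} _ _ = z≤n
  unique-⊆⇒length-≤ {x ∷ xs} {ys} (x∉xs ∷ !xs) xs⊆ys = ℕP.≤-trans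
      (s≤s (unique-⊆⇒length-≤ !xs λ y∈xs → ∈-─ x∈ys (xs⊆ys (there y∈xs)) (All.lookup x∉xs y∈xs ∘ sym)))
      (ℕP.≤-reflexive (sym (ListP.length-removeAt′ ys (index x∈ys))))
    where
      x∈ys : x ∈ₗ ys
      x∈ys = xs⊆ys (here refl)

module _ {n : ℕ} {P : Pred (Fin n) 0ℓ} (P? : Decidable P) where
  open import Data.List.Membership.DecPropositional (Fin._≟_ {n}) using (_∈?_)

  count : ℕ
  count = length (filter P? (allFin n))

  count-≥ : ∀ {xs} → Unique xs → All P xs → length xs ℕ.≤ count
  count-≥ !xs Pxs = unique-⊆⇒length-≤ !xs λ x∈xs → ∈-filter⁺ P? (∈-allFin _) (All.lookup Pxs x∈xs)

  count-≤ : ∀ {xs} → (∀ {x} → P x → x ∈ₗ xs) → count ℕ.≤ length xs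
  count-≤ P⊆xs = unique-⊆⇒length-≤ (Unique.filter⁺ P? (Unique.allFin⁺ n))
    λ x∈ → P⊆xs (proj₂ (∈-filter⁻ P? {xs = allFin n} x∈))

  count-complete : ∀ {xs x} → Unique xs → All P xs → count ≡ length xs → P x → x ∈ₗ xs
  count-complete {xs} {x} !xs Pxs count≡ Px = decidable-stable (x ∈? xs) λ x∉xs →
    ℕP.1+n≰n (ℕP.≤-trans (count-≥ (All.tabulate (λ y∈xs x≡y → x∉xs (subst (_∈ₗ xs) (sym x≡y) y∈xs)) ∷ !xs) (Px ∷ Pxs))
                        (ℕP.≤-reflexive count≡))

  count-extra : ∀ {xs} → Unique xs → All P xs → count ≢ length xs → ∃ λ x → P x × x ∉ xs
  count-extra {xs} !xs Pxs count≢ with any? (λ x → P? x ×-dec ¬? (x ∈? xs))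
  ... | yes found = found
  ... | no none = contradiction (ℕP.≤-antisym (count-≤ covered) (count-≥ !xs Pxs)) count≢
    where
      covered : ∀ {x} → P x → x ∈ₗ xs
      covered {x} Px = decidable-stable (x ∈? xs) λ x∉xs → none (x , Px , x∉xs)

foldr-tabulate : ∀ {n} (h : Fin n → ℤ) → foldr _+_ 0ℤ (List.tabulate h) ≡ sum h
foldr-tabulate {zero} h = refl
foldr-tabulate {suc n} h = cong (h Fin.zero +_) (foldr-tabulate (h ∘ Fin.suc))

+-mono-≤-equality : ∀ {a b c d} → a ≤ b → c ≤ d → a + c ≡ b + d → a ≡ b × c ≡ d
+-mono-≤-equality a≤b c≤d a+c≡b+d =
    ℤP.≤-antisym a≤b (ℤP.≮⇒≥ λ a<b → ℤP.<-irrefl a+c≡b+d (ℤP.+-mono-<-≤ a<b c≤d))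
  , ℤP.≤-antisym c≤d (ℤP.≮⇒≥ λ c<d → ℤP.<-irrefl a+c≡b+d (ℤP.+-mono-≤-< a≤b c<d))

sum-mono-≤ : ∀ {n} {f g : Fin n → ℤ} → (∀ i → f i ≤ g i) → sum f ≤ sum g
sum-mono-≤ {zero} _ = ℤP.≤-refl
sum-mono-≤ {suc n} f≤g = ℤP.+-mono-≤ (f≤g Fin.zero) (sum-mono-≤ (f≤g ∘ Fin.suc))

sum-mono-≤-equality : ∀ {n} {f g : Fin n → ℤ} → (∀ i → f i ≤ g i) → sum f ≡ sum g → ∀ i → f i ≡ g i
sum-mono-≤-equality {suc n} {f} {g} f≤g ∑f≡∑g = λ where
    Fin.zero → proj₁ heads-and-tails
    (Fin.suc i) → sum-mono-≤-equality (f≤g ∘ Fin.suc) (proj₂ heads-and-tails) i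
  where
    heads-and-tails : f Fin.zero ≡ g Fin.zero × sum (f ∘ Fin.suc) ≡ sum (g ∘ Fin.suc)
    heads-and-tails = +-mono-≤-equality (f≤g Fin.zero) (sum-mono-≤ (f≤g ∘ Fin.suc)) ∑f≡∑g

∑-symmetrise : ∀ {n} (x b : Fin n → ℤ) (a : Fin n → Fin n → ℤ) →
  sum (λ i → x i * (b i + sum (λ k → a i k + a k i))) ≡
  sum (λ i → x i * b i + sum (λ k → a i k * (x i + x k)))
∑-symmetrise x b a = begin
    sum (λ i → x i * (b i + sum (λ k → a i k + a k i)))
  ≡⟨ sum-cong-≗ expand ⟩
    sum (λ i → (x i * b i + sum (λ k → x i * a i k)) + sum (λ k → x i * a k i))
  ≡⟨ ∑-distrib-+ (λ i → x i * b i + sum (λ k → x i * a i k)) (λ i → sum (λ k → x i * a k i)) ⟩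
    sum (λ i → x i * b i + sum (λ k → x i * a i k)) + sum (λ i → sum (λ k → x i * a k i))
  ≡⟨ cong (sum (λ i → x i * b i + sum (λ k → x i * a i k)) +_) (∑-comm (λ i k → x i * a k i)) ⟩
    sum (λ i → x i * b i + sum (λ k → x i * a i k)) + sum (λ i → sum (λ k → x k * a i k))
  ≡⟨ ∑-distrib-+ (λ i → x i * b i + sum (λ k → x i * a i k)) (λ i → sum (λ k → x k * a i k)) ⟨
    sum (λ i → (x i * b i + sum (λ k → x i * a i k)) + sum (λ k → x k * a i k))
  ≡⟨ sum-cong-≗ collect ⟩
    sum (λ i → x i * b i + sum (λ k → a i k * (x i + x k))) ∎
  where
    open ≡-Reasoning
    expand : ∀ i → x i * (b i + sum (λ k → a i k + a k i)) ≡
                   (x i * b i + sum (λ k → x i * a i k)) + sum (λ k → x i * a k i)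
    expand i = begin
        x i * (b i + sum (λ k → a i k + a k i))
      ≡⟨ ℤP.*-distribˡ-+ (x i) (b i) _ ⟩
        x i * b i + x i * sum (λ k → a i k + a k i)
      ≡⟨ cong (x i * b i +_) (*-distribˡ-sum (x i) (λ k → a i k + a k i)) ⟩
        x i * b i + sum (λ k → x i * (a i k + a k i))
      ≡⟨ cong (x i * b i +_) (sum-cong-≗ λ k → ℤP.*-distribˡ-+ (x i) (a i k) (a k i)) ⟩
        x i * b i + sum (λ k → x i * a i k + x i * a k i)
      ≡⟨ cong (x i * b i +_) (∑-distrib-+ (λ k → x i * a i k) (λ k → x i * a k i)) ⟩
        x i * b i + (sum (λ k → x i * a i k) + sum (λ k → x i * a k i))
      ≡⟨ ℤP.+-assoc (x i * b i) _ _ ⟨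
        (x i * b i + sum (λ k → x i * a i k)) + sum (λ k → x i * a k i) ∎
    collect : ∀ i → (x i * b i + sum (λ k → x i * a i k)) + sum (λ k → x k * a i k) ≡
                    x i * b i + sum (λ k → a i k * (x i + x k))
    collect i = begin
        (x i * b i + sum (λ k → x i * a i k)) + sum (λ k → x k * a i k)
      ≡⟨ ℤP.+-assoc (x i * b i) _ _ ⟩
        x i * b i + (sum (λ k → x i * a i k) + sum (λ k → x k * a i k))
      ≡⟨ cong (x i * b i +_) (∑-distrib-+ (λ k → x i * a i k) (λ k → x k * a i k)) ⟨
        x i * b i + sum (λ k → x i * a i k + x k * a i k)
      ≡⟨ cong (x i * b i +_) (sum-cong-≗ λ k → trans (sym (ℤP.*-distribʳ-+ (a i k) (x i) (x k))) (ℤP.*-comm (x i + x k) (a i k))) ⟩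
        x i * b i + sum (λ k → a i k * (x i + x k)) ∎

⟦_⟧ : Bool → ℤ
⟦ true ⟧ = 1ℤ
⟦ false ⟧ = 0ℤ

if-then-0≡⟦⟧* : ∀ b x → (if b then x else 0ℤ) ≡ ⟦ b ⟧ * x
if-then-0≡⟦⟧* true x = sym (ℤP.*-identityˡ x)
if-then-0≡⟦⟧* false x = refl

lookup-extensional : ∀ {A : Set} {n} {xs ys : Vec.Vec A n} → (∀ i → lookup xs i ≡ lookup ys i) → xs ≡ ys
lookup-extensional {xs = xs} {ys} xs≗ys =
  trans (sym (VecP.tabulate∘lookup xs)) (trans (VecP.tabulate-cong xs≗ys) (VecP.tabulate∘lookup ys))

agreement : Bool → Bool → ℤ
agreement true true = 1ℤ
agreement false false = -1ℤ
agreement true false = 0ℤ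
agreement false true = 0ℤ

agreement-≤ : ∀ l x y → ⟦ l ⟧ * agreement x y ≤ ⟦ x ⟧ * agreement x y
agreement-≤ true true true = ℤP.≤-refl
agreement-≤ false true true = +≤+ z≤n
agreement-≤ true false false = -≤+
agreement-≤ false false false = ℤP.≤-refl
agreement-≤ true true false = ℤP.≤-refl
agreement-≤ false true false = ℤP.≤-refl
agreement-≤ true false true = ℤP.≤-refl
agreement-≤ false false true = ℤP.≤-refl

agreement-swap : ∀ x y → ⟦ y ⟧ * agreement x y ≡ ⟦ x ⟧ * agreement x y
agreement-swap true true = refl
agreement-swap false false = refl
agreement-swap true false = refl
agreement-swap false true = refl

agreement-equality : ∀ l x y → x ≡ y → ⟦ l ⟧ * agreement x y ≡ ⟦ x ⟧ * agreement x y → l ≡ x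
agreement-equality true true _ refl _ = refl
agreement-equality false false _ refl _ = refl

indicator-sum-≤1 : ∀ a b → ¬ (a ≡ true × b ≡ true) → ⟦ a ⟧ + ⟦ b ⟧ ≤ 1ℤ
indicator-sum-≤1 true true not-both = contradiction (refl , refl) not-both
indicator-sum-≤1 true false _ = ℤP.≤-refl
indicator-sum-≤1 false true _ = ℤP.≤-refl
indicator-sum-≤1 false false _ = +≤+ z≤n

indicator-sum-≡1 : ∀ a b → ⟦ a ⟧ + ⟦ b ⟧ ≡ 1ℤ → a ≡ not b
indicator-sum-≡1 true false _ = refl
indicator-sum-≡1 false true _ = refl

xor-false : ∀ x y → x xor y ≡ false → y ≡ x
xor-false true true _ = refl
xor-false false false _ = refl

xor-true : ∀ x y → x xor y ≡ true → y ≡ not x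
xor-true true false _ = refl
xor-true false true _ = refl

module _ (G : Graph) where
  open Graph G

  -- Bonds, pendant edges and cliques of the line graph

  Touch : Fin m → Fin m → Set
  Touch i k = ∃ λ v → Incident G v i × Incident G v k

  touch? : ∀ i k → Dec (Touch i k)
  touch? i k = any? λ v → incident? G v i ×-dec incident? G v k

  touch-refl : ∀ i → Touch i i
  touch-refl i = proj₁ (ends i) , inj₁ refl , inj₁ refl

  touch-sym : ∀ {i k} → Touch i k → Touch k i
  touch-sym (v , vi , vk) = v , vk , vi

  CliqueNeighbourhood : Fin m → Set
  CliqueNeighbourhood e = ∀ {f g} → Touch f e → Touch g e → Touch f g

  clique-or-witness : ∀ e → CliqueNeighbourhood e ⊎ ∃₂ λ f g → Touch f e × Touch g e × ¬ Touch f g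
  clique-or-witness e with any? (λ f → any? λ g → touch? f e ×-dec touch? g e ×-dec ¬? (touch? f g))
  ... | yes (f , g , witness) = inj₂ (f , g , witness)
  ... | no none = inj₁ λ {f} {g} fe ge → decidable-stable (touch? f g) λ ¬fg → none (f , g , fe , ge , ¬fg)

  endpoints : ∀ {x y i} → Incident G x i → Incident G y i → x ≢ y →
              (x ≡ proj₁ (ends i) × y ≡ proj₂ (ends i)) ⊎ (x ≡ proj₂ (ends i) × y ≡ proj₁ (ends i))
  endpoints (inj₁ refl) (inj₁ refl) x≢y = contradiction refl x≢y
  endpoints (inj₁ refl) (inj₂ refl) _   = inj₁ (refl , refl)
  endpoints (inj₂ refl) (inj₁ refl) _   = inj₂ (refl , refl)
  endpoints (inj₂ refl) (inj₂ refl) x≢y = contradiction refl x≢y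

  third-endpoint : ∀ {x y z i} → Incident G x i → Incident G y i → x ≢ y → Incident G z i → z ≡ x ⊎ z ≡ y
  third-endpoint xi yi x≢y (inj₁ refl) with endpoints xi yi x≢y
  ... | inj₁ (refl , _) = inj₁ refl
  ... | inj₂ (_ , refl) = inj₂ refl
  third-endpoint xi yi x≢y (inj₂ refl) with endpoints xi yi x≢y
  ... | inj₁ (_ , refl) = inj₂ refl
  ... | inj₂ (refl , _) = inj₁ refl

  same-endpoints : ∀ {x y i k} → Incident G x i → Incident G y i → Incident G x k → Incident G y k → x ≢ y → i ≡ k
  same-endpoints xi yi xk yk x≢y with endpoints xi yi x≢y | endpoints xk yk x≢y
  ... | inj₁ (refl , refl) | inj₁ (p , q) = simple _ _ (inj₁ (p , q))
  ... | inj₁ (refl , refl) | inj₂ (p , q) = simple _ _ (inj₂ (p , q))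
  ... | inj₂ (refl , refl) | inj₁ (p , q) = simple _ _ (inj₂ (q , p))
  ... | inj₂ (refl , refl) | inj₂ (p , q) = simple _ _ (inj₁ (q , p))

  adjacent⇒edge : ∀ {u w} → AdjV G u w → ∃ λ k → Incident G u k × Incident G w k × u ≢ w
  adjacent⇒edge (k , inj₁ (refl , refl)) = k , inj₁ refl , inj₂ refl , noLoop k
  adjacent⇒edge (k , inj₂ (refl , refl)) = k , inj₂ refl , inj₁ refl , noLoop k ∘ sym

  edge⇒adjacent : ∀ {u w k} → Incident G u k → Incident G w k → u ≢ w → AdjV G u w
  edge⇒adjacent uk wk u≢w with endpoints uk wk u≢w
  ... | inj₁ (refl , refl) = _ , inj₁ (refl , refl)
  ... | inj₂ (refl , refl) = _ , inj₂ (refl , refl)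

  adjacent-irrefl : ∀ {u} → ¬ AdjV G u u
  adjacent-irrefl uu = let (_ , _ , _ , u≢u) = adjacent⇒edge uu in u≢u refl

  degree-≥2 : ∀ {v e f} → Incident G v e → Incident G v f → e ≢ f → 2 ℕ.≤ vdeg G v
  degree-≥2 {v} ve vf e≢f = count-≥ (incident? G v) ((e≢f ∷ []) ∷ [] ∷ []) (ve ∷ vf ∷ [])

  degree-2-edges : ∀ {v e f k} → vdeg G v ≡ 2 → Incident G v e → Incident G v f → e ≢ f →
                   Incident G v k → k ≡ e ⊎ k ≡ f
  degree-2-edges {v} deg ve vf e≢f vk
    with count-complete (incident? G v) ((e≢f ∷ []) ∷ [] ∷ []) (ve ∷ vf ∷ []) deg vk
  ... | here k≡e = inj₁ k≡e
  ... | there (here k≡f) = inj₂ k≡f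

  another-edge : ∀ {v e} → vdeg G v ≢ 1 → Incident G v e → ∃ λ f → Incident G v f × f ≢ e
  another-edge {v} deg≢1 ve with count-extra (incident? G v) ([] ∷ []) (ve ∷ []) deg≢1
  ... | f , vf , f∉[e] = f , vf , f∉[e] ∘ here

  third-edge : ∀ {v e f} → vdeg G v ≢ 2 → Incident G v e → Incident G v f → e ≢ f →
               ∃ λ k → Incident G v k × k ≢ e × k ≢ f
  third-edge {v} deg≢2 ve vf e≢f
    with count-extra (incident? G v) ((e≢f ∷ []) ∷ [] ∷ []) (ve ∷ vf ∷ []) deg≢2
  ... | k , vk , k∉[e,f] = k , vk , k∉[e,f] ∘ here , k∉[e,f] ∘ there ∘ here

  -- x has degree 2, so its edges are e and f; a common neighbour of x and y cannot be reached along e.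
  common-neighbour-on : ∀ {x y w e f} → vdeg G x ≡ 2 → Incident G x e → Incident G y e → x ≢ y →
                        Incident G x f → f ≢ e → AdjV G x w → AdjV G y w → Incident G w f
  common-neighbour-on deg xe ye x≢y xf f≢e xw yw with adjacent⇒edge xw
  ... | k , xk , wk , x≢w with degree-2-edges deg xe xf (f≢e ∘ sym) xk
  ...   | inj₂ refl = wk
  ...   | inj₁ refl with third-endpoint xe ye x≢y wk
  ...     | inj₁ refl = contradiction refl x≢w
  ...     | inj₂ refl = contradiction yw adjacent-irrefl

  bond-or-pendant⇒clique : ∀ {e} → Bond G e ⊎ Pendant G e → CliqueNeighbourhood e
  bond-or-pendant⇒clique {e} bp {f} {g} (x , xf , xe) (y , yg , ye) with f ≟ e | g ≟ e | x ≟ y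
  ... | yes refl | _ | _ = touch-sym (y , yg , ye)
  ... | no _ | yes refl | _ = x , xf , xe
  ... | no _ | no _ | yes refl = x , xf , yg
  ... | no f≢e | no g≢e | no x≢y = meet bp (endpoints xe ye x≢y)
    where
      ends-≥2 : ∀ {z} → Incident G z e → 2 ℕ.≤ vdeg G z
      ends-≥2 ze with third-endpoint xe ye x≢y ze
      ... | inj₁ refl = degree-≥2 xe xf (f≢e ∘ sym)
      ... | inj₂ refl = degree-≥2 ye yg (g≢e ∘ sym)
      not-1 : ∀ {z} → Incident G z e → vdeg G z ≢ 1
      not-1 ze deg≡1 = contradiction (subst (2 ℕ.≤_) deg≡1 (ends-≥2 ze)) λ { (s≤s ()) }
      meet : Bond G e ⊎ Pendant G e →
             (x ≡ proj₁ (ends e) × y ≡ proj₂ (ends e)) ⊎ (x ≡ proj₂ (ends e) × y ≡ proj₁ (ends e)) →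
             Touch f g
      meet (inj₂ (inj₁ deg≡1)) _ = contradiction deg≡1 (not-1 (inj₁ refl))
      meet (inj₂ (inj₂ deg≡1)) _ = contradiction deg≡1 (not-1 (inj₂ refl))
      meet (inj₁ (deg₁ , deg₂ , one-common)) orientation
        with count-extra (λ w → adjV? G (proj₁ (ends e)) w ×-dec adjV? G (proj₂ (ends e)) w) [] []
                         (λ none → contradiction (trans (sym one-common) none) λ ())
      meet (inj₁ (deg₁ , deg₂ , _)) (inj₁ (refl , refl)) | w , (xw , yw) , _ =
        w , common-neighbour-on deg₁ xe ye x≢y xf f≢e xw yw , common-neighbour-on deg₂ ye xe (x≢y ∘ sym) yg g≢e yw xw
      meet (inj₁ (deg₁ , deg₂ , _)) (inj₂ (refl , refl)) | w , (yw , xw) , _ =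
        w , common-neighbour-on deg₂ xe ye x≢y xf f≢e xw yw , common-neighbour-on deg₁ ye xe (x≢y ∘ sym) yg g≢e yw xw

  -- A third edge k at x would have to meet g, but the only endpoints of g are y and w.
  clique⇒degree-2 : ∀ {e f g x y w} → CliqueNeighbourhood e → Incident G x e → Incident G y e → x ≢ y →
               Incident G x f → f ≢ e → Incident G y g → Incident G w f → Incident G w g → w ≢ x → w ≢ y →
               vdeg G x ≡ 2
  clique⇒degree-2 {x = x} {y} clique xe ye x≢y xf f≢e yg wf wg w≢x w≢y with vdeg G x ℕ.≟ 2
  ... | yes deg≡2 = deg≡2
  ... | no deg≢2 with third-edge deg≢2 xe xf (f≢e ∘ sym)
  ... | k , xk , k≢e , k≢f with clique (x , xk , xe) (y , yg , ye)
  ... | z , zk , zg with third-endpoint yg wg (w≢y ∘ sym) zg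
  ... | inj₁ refl = contradiction (same-endpoints xk zk xe ye x≢y) k≢e
  ... | inj₂ refl = contradiction (same-endpoints xk zk xf wf (w≢x ∘ sym)) k≢f

  clique⇒bond-or-pendant : ∀ {e} → CliqueNeighbourhood e → Bond G e ⊎ Pendant G e
  clique⇒bond-or-pendant {e} clique with vdeg G (proj₁ (ends e)) ℕ.≟ 1 | vdeg G (proj₂ (ends e)) ℕ.≟ 1
  ... | yes deg≡1 | _ = inj₂ (inj₁ deg≡1)
  ... | no _ | yes deg≡1 = inj₂ (inj₂ deg≡1)
  ... | no deg₁≢1 | no deg₂≢1 with another-edge deg₁≢1 (inj₁ refl) | another-edge deg₂≢1 (inj₂ refl)
  ... | f , uf , f≢e | g , vg , g≢e with clique (_ , uf , inj₁ refl) (_ , vg , inj₂ refl)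
  ... | w , wf , wg = inj₁ (deg-u , deg-v , one-common-neighbour)
    where
      u≢v : proj₁ (ends e) ≢ proj₂ (ends e)
      u≢v = noLoop e
      w≢u : w ≢ proj₁ (ends e)
      w≢u refl = g≢e (same-endpoints wg vg (inj₁ refl) (inj₂ refl) u≢v)
      w≢v : w ≢ proj₂ (ends e)
      w≢v refl = f≢e (same-endpoints uf wf (inj₁ refl) (inj₂ refl) u≢v)
      deg-u : vdeg G (proj₁ (ends e)) ≡ 2
      deg-u = clique⇒degree-2 clique (inj₁ refl) (inj₂ refl) u≢v uf f≢e vg wf wg w≢u w≢v
      deg-v : vdeg G (proj₂ (ends e)) ≡ 2
      deg-v = clique⇒degree-2 clique (inj₂ refl) (inj₁ refl) (u≢v ∘ sym) vg g≢e uf wg wf w≢v w≢u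
      only-w : ∀ {w′} → AdjV G (proj₁ (ends e)) w′ × AdjV G (proj₂ (ends e)) w′ → w′ ∈ₗ w ∷ []
      only-w (uw′ , vw′) with third-endpoint uf wf (w≢u ∘ sym)
                                (common-neighbour-on deg-u (inj₁ refl) (inj₂ refl) u≢v uf f≢e uw′ vw′)
      ... | inj₁ refl = contradiction uw′ adjacent-irrefl
      ... | inj₂ w′≡w = here w′≡w
      one-common-neighbour : commonNbrs G (proj₁ (ends e)) (proj₂ (ends e)) ≡ 1
      one-common-neighbour = ℕP.≤-antisym
        (count-≤ (λ w′ → adjV? G (proj₁ (ends e)) w′ ×-dec adjV? G (proj₂ (ends e)) w′) only-w)
        (count-≥ (λ w′ → adjV? G (proj₁ (ends e)) w′ ×-dec adjV? G (proj₂ (ends e)) w′) ([] ∷ [])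
                 ((edge⇒adjacent uf wf (w≢u ∘ sym) , edge⇒adjacent vg wg (w≢v ∘ sym)) ∷ []))

  -- Edges of the matching polytope

  Matching : Subset m → Set
  Matching X = ∀ {i k} → lookup X i ≡ true → lookup X k ≡ true → i ≢ k → ¬ Touch i k

  IsMatching⇒Matching : ∀ {X} → IsMatching G X → Matching X
  IsMatching⇒Matching {X} X-matching {i} {k} Xi Xk =
    X-matching i k (VecP.lookup⇒[]= i X Xi) (VecP.lookup⇒[]= k X Xk)

  Matching⇒IsMatching : ∀ {X} → Matching X → IsMatching G X
  Matching⇒IsMatching X-matching i k i∈X k∈X = X-matching (VecP.[]=⇒lookup i∈X) (VecP.[]=⇒lookup k∈X)

  weight≡sum : ∀ c X → weight G c X ≡ sum (λ i → ⟦ lookup X i ⟧ * c i)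
  weight≡sum c X = begin
      foldr _+_ 0ℤ (List.map (λ i → if lookup X i then c i else 0ℤ) (allFin m))
    ≡⟨ cong (foldr _+_ 0ℤ) (ListP.map-tabulate id (λ i → if lookup X i then c i else 0ℤ)) ⟩
      foldr _+_ 0ℤ (List.tabulate (λ i → if lookup X i then c i else 0ℤ))
    ≡⟨ foldr-tabulate (λ i → if lookup X i then c i else 0ℤ) ⟩
      sum (λ i → if lookup X i then c i else 0ℤ)
    ≡⟨ sum-cong-≗ (λ i → if-then-0≡⟦⟧* (lookup X i) (c i)) ⟩
      sum (λ i → ⟦ lookup X i ⟧ * c i) ∎
    where open ≡-Reasoning

  _∈_∖_ : Fin m → Subset m → Subset m → Set
  i ∈ X ∖ Y = lookup X i ≡ true × lookup Y i ≡ false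

  module Exposing (M N : Subset m) where

    Alternating : Fin m → Fin m → Set
    Alternating i k = i ∈ M ∖ N × k ∈ N ∖ M × Touch i k

    alternating? : ∀ i k → Dec (Alternating i k)
    alternating? i k = ((lookup M i Bool.≟ true) ×-dec (lookup N i Bool.≟ false))
                ×-dec ((lookup N k Bool.≟ true) ×-dec (lookup M k Bool.≟ false)) ×-dec touch? i k

    alternating : Fin m → Fin m → ℤ
    alternating i k = ⟦ does (alternating? i k) ⟧

    -- Maximised over the matchings exactly by those that agree with M and N where they agree
    -- and contain exactly one edge of each alternating pair.
    exposing : Fin m → ℤ
    exposing i = agreement (lookup M i) (lookup N i) + sum (λ k → alternating i k + alternating k i)

    agreementTerm : Subset m → Fin m → ℤ
    agreementTerm L i = ⟦ lookup L i ⟧ * agreement (lookup M i) (lookup N i)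

    pairTerm : Subset m → Fin m → Fin m → ℤ
    pairTerm L i k = alternating i k * (⟦ lookup L i ⟧ + ⟦ lookup L k ⟧)

    rowTerm : Subset m → Fin m → ℤ
    rowTerm L i = agreementTerm L i + sum (pairTerm L i)

    weight-exposing : ∀ L → weight G exposing L ≡ sum (rowTerm L)
    weight-exposing L = trans (weight≡sum exposing L)
      (∑-symmetrise (λ i → ⟦ lookup L i ⟧) (λ i → agreement (lookup M i) (lookup N i)) alternating)

    pairTerm-≤ : ∀ {L} → Matching L → ∀ i k → pairTerm L i k ≤ pairTerm M i k
    pairTerm-≤ {L} L-matching i k = by-cases (alternating? i k)
      where
        by-cases : (d : Dec (Alternating i k)) →
                   ⟦ does d ⟧ * (⟦ lookup L i ⟧ + ⟦ lookup L k ⟧) ≤ ⟦ does d ⟧ * (⟦ lookup M i ⟧ + ⟦ lookup M k ⟧)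
        by-cases (no _) = ℤP.≤-refl
        by-cases (yes ((Mi , _) , (_ , Mk) , i~k)) rewrite Mi | Mk | ℤP.*-identityˡ (⟦ lookup L i ⟧ + ⟦ lookup L k ⟧) =
          indicator-sum-≤1 (lookup L i) (lookup L k) λ (Li , Lk) →
            L-matching Li Lk (λ { refl → contradiction (trans (sym Mi) Mk) λ () }) i~k

    pairTerm-swap : ∀ i k → pairTerm N i k ≡ pairTerm M i k
    pairTerm-swap i k = by-cases (alternating? i k)
      where
        by-cases : (d : Dec (Alternating i k)) →
                   ⟦ does d ⟧ * (⟦ lookup N i ⟧ + ⟦ lookup N k ⟧) ≡ ⟦ does d ⟧ * (⟦ lookup M i ⟧ + ⟦ lookup M k ⟧)
        by-cases (no _) = refl
        by-cases (yes ((Mi , Ni) , (Nk , Mk) , _)) rewrite Mi | Ni | Mk | Nk = refl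

    pairTerm-equality : ∀ {L i k} → pairTerm L i k ≡ pairTerm M i k → Alternating i k → lookup L i ≡ not (lookup L k)
    pairTerm-equality {L} {i} {k} = by-cases (alternating? i k)
      where
        by-cases : (d : Dec (Alternating i k)) →
                   ⟦ does d ⟧ * (⟦ lookup L i ⟧ + ⟦ lookup L k ⟧) ≡ ⟦ does d ⟧ * (⟦ lookup M i ⟧ + ⟦ lookup M k ⟧) →
                   Alternating i k → lookup L i ≡ not (lookup L k)
        by-cases (no ¬alt) _ alt = contradiction alt ¬alt
        by-cases (yes ((Mi , _) , (_ , Mk) , _)) eq _ rewrite Mi | Mk =
          indicator-sum-≡1 (lookup L i) (lookup L k) (trans (sym (ℤP.*-identityˡ _)) eq)

    rowTerm-≤ : ∀ {L} → Matching L → ∀ i → rowTerm L i ≤ rowTerm M i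
    rowTerm-≤ {L} L-matching i = ℤP.+-mono-≤ (agreement-≤ (lookup L i) (lookup M i) (lookup N i))
                                         (sum-mono-≤ (pairTerm-≤ {L} L-matching i))

    weight-N≡weight-M : weight G exposing N ≡ weight G exposing M
    weight-N≡weight-M = begin
        weight G exposing N
      ≡⟨ weight-exposing N ⟩
        sum (rowTerm N)
      ≡⟨ sum-cong-≗ (λ i → cong₂ _+_ (agreement-swap (lookup M i) (lookup N i)) (sum-cong-≗ (pairTerm-swap i))) ⟩
        sum (rowTerm M)
      ≡⟨ weight-exposing M ⟨
        weight G exposing M ∎
      where open ≡-Reasoning

    record Rigid (L : Subset m) : Set where
      field
        agrees : ∀ i → lookup M i ≡ lookup N i → lookup L i ≡ lookup M i
        alternates : ∀ {i k} → Alternating i k → lookup L i ≡ not (lookup L k)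

    exposing-maximal : ∀ {L} → Matching L → weight G exposing L < weight G exposing M ⊎ Rigid L
    exposing-maximal {L} L-matching with weight G exposing L ℤ.≟ weight G exposing M
    ... | no L≢M = inj₁ (ℤP.≤∧≢⇒< weight-≤ L≢M)
      where
        weight-≤ : weight G exposing L ≤ weight G exposing M
        weight-≤ = subst₂ _≤_ (sym (weight-exposing L)) (sym (weight-exposing M)) (sum-mono-≤ (rowTerm-≤ {L} L-matching))
    ... | yes L≡M = inj₂ record
        { agrees = λ i Mi≡Ni → agreement-equality (lookup L i) (lookup M i) (lookup N i) Mi≡Ni (proj₁ (row≡ i))
        ; alternates = λ {i} {k} alt → pairTerm-equality {L} (sum-mono-≤-equality (pairTerm-≤ {L} L-matching i) (proj₂ (row≡ i)) k) alt
        }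
      where
        rows≡ : ∀ i → rowTerm L i ≡ rowTerm M i
        rows≡ = sum-mono-≤-equality (rowTerm-≤ {L} L-matching)
                  (trans (sym (weight-exposing L)) (trans L≡M (weight-exposing M)))
        row≡ : ∀ i → agreementTerm L i ≡ agreementTerm M i × sum (pairTerm L i) ≡ sum (pairTerm M i)
        row≡ i = +-mono-≤-equality (agreement-≤ (lookup L i) (lookup M i) (lookup N i)) (sum-mono-≤ (pairTerm-≤ {L} L-matching i)) (rows≡ i)

    Linked : Fin m → Fin m → Set
    Linked = EqClosure Alternating

    -- M i xor L i records whether L disagrees with M at i.
    rigid-constant-on-linked : ∀ {L i k} → Rigid L → Linked i k → lookup M i xor lookup L i ≡ lookup M k xor lookup L k
    rigid-constant-on-linked {L} rigid = gfold isEquivalence (λ i → lookup M i xor lookup L i) step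
      where
        step : ∀ {i k} → Alternating i k → lookup M i xor lookup L i ≡ lookup M k xor lookup L k
        step alt@((Mi , _) , (_ , Mk) , _) rewrite Mi | Mk | Rigid.alternates rigid alt = not-involutive _

    rigid-is-M-or-N : ∀ {h L} → lookup M h ≢ lookup N h → (∀ d → lookup M d ≢ lookup N d → Linked h d) →
                               Rigid L → L ≡ M ⊎ L ≡ N
    rigid-is-M-or-N {h} {L} Mh≢Nh connected rigid with lookup M h xor lookup L h in Mh-xor-Lh
    ... | false = inj₁ (lookup-extensional λ d → by-cases d (lookup M d Bool.≟ lookup N d))
      where
        by-cases : ∀ d → Dec (lookup M d ≡ lookup N d) → lookup L d ≡ lookup M d
        by-cases d (yes Md≡Nd) = Rigid.agrees rigid d Md≡Nd
        by-cases d (no Md≢Nd) = xor-false (lookup M d) (lookup L d)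
          (trans (sym (rigid-constant-on-linked rigid (connected d Md≢Nd))) Mh-xor-Lh)
    ... | true = inj₂ (lookup-extensional λ d → by-cases d (lookup M d Bool.≟ lookup N d))
      where
        by-cases : ∀ d → Dec (lookup M d ≡ lookup N d) → lookup L d ≡ lookup N d
        by-cases d (yes Md≡Nd) = trans (Rigid.agrees rigid d Md≡Nd) Md≡Nd
        by-cases d (no Md≢Nd) = trans (xor-true (lookup M d) (lookup L d)
          (trans (sym (rigid-constant-on-linked rigid (connected d Md≢Nd))) Mh-xor-Lh)) (sym (¬-not (Md≢Nd ∘ sym)))

    connected⇒adjacent : ∀ {h} → lookup M h ≢ lookup N h → (∀ d → lookup M d ≢ lookup N d → Linked h d) → SkelAdj G M N
    connected⇒adjacent Mh≢Nh connected =
        (λ { refl → Mh≢Nh refl }) , exposing , sym weight-N≡weight-M , strict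
      where
        strict : ∀ L → IsMatching G L → L ≢ M → L ≢ N → weight G exposing L < weight G exposing M
        strict L L-matching L≢M L≢N with exposing-maximal (IsMatching⇒Matching L-matching)
        ... | inj₁ lt = lt
        ... | inj₂ rigid with rigid-is-M-or-N Mh≢Nh connected rigid
        ...   | inj₁ L≡M = contradiction L≡M L≢M
        ...   | inj₂ L≡N = contradiction L≡N L≢N

  mix : (Fin m → Bool) → Subset m → Subset m → Subset m
  mix D X Y = tabulate λ i → if D i then lookup X i else lookup Y i

  lookup-mix : ∀ D X Y i → lookup (mix D X Y) i ≡ (if D i then lookup X i else lookup Y i)
  lookup-mix D X Y = VecP.lookup∘tabulate _

  mix-swap : ∀ D X Y → mix D X Y ≡ X → mix D Y X ≡ Y
  mix-swap D X Y mix≡X = lookup-extensional λ i →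
      pointwise i (trans (sym (lookup-mix D X Y i)) (cong (λ Z → lookup Z i) mix≡X))
    where
      pointwise : ∀ i → (if D i then lookup X i else lookup Y i) ≡ lookup X i → lookup (mix D Y X) i ≡ lookup Y i
      pointwise i Yi≡Xi rewrite lookup-mix D Y X i with D i
      ... | true = refl
      ... | false = sym Yi≡Xi

  mix-swap′ : ∀ D X Y → mix D X Y ≡ Y → mix D Y X ≡ X
  mix-swap′ D X Y mix≡Y = lookup-extensional λ i →
      pointwise i (trans (sym (lookup-mix D X Y i)) (cong (λ Z → lookup Z i) mix≡Y))
    where
      pointwise : ∀ i → (if D i then lookup X i else lookup Y i) ≡ lookup Y i → lookup (mix D Y X) i ≡ lookup X i
      pointwise i Xi≡Yi rewrite lookup-mix D Y X i with D i
      ... | true = sym Xi≡Yi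
      ... | false = refl

  weight-mix : ∀ c D X Y → weight G c (mix D X Y) + weight G c (mix D Y X) ≡ weight G c X + weight G c Y
  weight-mix c D X Y = begin
      weight G c (mix D X Y) + weight G c (mix D Y X)
    ≡⟨ cong₂ _+_ (weight≡sum c (mix D X Y)) (weight≡sum c (mix D Y X)) ⟩
      sum (λ i → ⟦ lookup (mix D X Y) i ⟧ * c i) + sum (λ i → ⟦ lookup (mix D Y X) i ⟧ * c i)
    ≡⟨ ∑-distrib-+ (λ i → ⟦ lookup (mix D X Y) i ⟧ * c i) (λ i → ⟦ lookup (mix D Y X) i ⟧ * c i) ⟨
      sum (λ i → ⟦ lookup (mix D X Y) i ⟧ * c i + ⟦ lookup (mix D Y X) i ⟧ * c i)
    ≡⟨ sum-cong-≗ pointwise ⟩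
      sum (λ i → ⟦ lookup X i ⟧ * c i + ⟦ lookup Y i ⟧ * c i)
    ≡⟨ ∑-distrib-+ (λ i → ⟦ lookup X i ⟧ * c i) (λ i → ⟦ lookup Y i ⟧ * c i) ⟩
      sum (λ i → ⟦ lookup X i ⟧ * c i) + sum (λ i → ⟦ lookup Y i ⟧ * c i)
    ≡⟨ cong₂ _+_ (weight≡sum c X) (weight≡sum c Y) ⟨
      weight G c X + weight G c Y ∎
    where
      open ≡-Reasoning
      pointwise : ∀ i → ⟦ lookup (mix D X Y) i ⟧ * c i + ⟦ lookup (mix D Y X) i ⟧ * c i ≡
                        ⟦ lookup X i ⟧ * c i + ⟦ lookup Y i ⟧ * c i
      pointwise i rewrite lookup-mix D X Y i | lookup-mix D Y X i with D i
      ... | true = refl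
      ... | false = ℤP.+-comm (⟦ lookup Y i ⟧ * c i) (⟦ lookup X i ⟧ * c i)

  -- χ_P + χ_Q = χ_M + χ_N for the two mixes P and Q, and an edge of the polytope admits no other such decomposition.
  adjacent-recombination : ∀ {M N} D → SkelAdj G M N → Matching (mix D M N) → Matching (mix D N M) →
                           mix D N M ≡ M ⊎ mix D N M ≡ N
  adjacent-recombination {M} {N} D (_ , c , wM≡wN , strict) P-matching Q-matching
    with VecP.≡-dec Bool._≟_ (mix D N M) M | VecP.≡-dec Bool._≟_ (mix D N M) N
  ... | yes Q≡M | _ = inj₁ Q≡M
  ... | no _ | yes Q≡N = inj₂ Q≡N
  ... | no Q≢M | no Q≢N = contradiction (weight-mix c D M N) (ℤP.<⇒≢ (subst (weight G c (mix D M N) + weight G c (mix D N M) <_) (cong (weight G c M +_) wM≡wN)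
          (ℤP.+-mono-< (strict _ (Matching⇒IsMatching P-matching) P≢M P≢N)
                       (strict _ (Matching⇒IsMatching Q-matching) Q≢M Q≢N))))
    where
      P≢M : mix D M N ≢ M
      P≢M P≡M = Q≢N (mix-swap D M N P≡M)
      P≢N : mix D M N ≢ N
      P≢N P≡N = Q≢M (mix-swap′ D M N P≡N)

  -- Toggling an edge

  -- Adds j and drops the edges of X meeting it; when X is a matching containing j, this just drops j.
  toggle : Subset m → Fin m → Subset m
  toggle X j = tabulate λ i → if does (i ≟ j) then not (lookup X j) else lookup X i ∧ not (does (touch? j i))

  lookup-toggle : ∀ X j i → lookup (toggle X j) i ≡
                  (if does (i ≟ j) then not (lookup X j) else lookup X i ∧ not (does (touch? j i)))
  lookup-toggle X j = VecP.lookup∘tabulate _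

  toggle-self : ∀ X j → lookup (toggle X j) j ≡ not (lookup X j)
  toggle-self X j rewrite lookup-toggle X j j | dec-true (j ≟ j) refl = refl

  toggle-meeting : ∀ X {i j} → i ≢ j → Touch j i → lookup (toggle X j) i ≡ false
  toggle-meeting X {i} {j} i≢j j~i
    rewrite lookup-toggle X j i | dec-false (i ≟ j) i≢j | dec-true (touch? j i) j~i = ∧-zeroʳ (lookup X i)

  toggle-far : ∀ X {i j} → ¬ Touch j i → lookup (toggle X j) i ≡ lookup X i
  toggle-far X {i} {j} j≁i
    rewrite lookup-toggle X j i | dec-false (i ≟ j) (λ { refl → j≁i (touch-refl i) })
          | dec-false (touch? j i) j≁i = ∧-identityʳ (lookup X i)

  toggle-other : ∀ X {i j} → lookup (toggle X j) i ≡ true → i ≢ j → lookup X i ≡ true × ¬ Touch j i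
  toggle-other X {i} {j} Ti i≢j with touch? j i
  ... | yes j~i = contradiction (trans (sym Ti) (toggle-meeting X i≢j j~i)) λ ()
  ... | no j≁i = trans (sym (toggle-far X j≁i)) Ti , j≁i

  toggle-new : ∀ X {i j} → lookup (toggle X j) i ≡ true → lookup X i ≡ false → i ≡ j
  toggle-new X {i} {j} Ti Xi = decidable-stable (i ≟ j) λ i≢j →
    contradiction (trans (sym Xi) (proj₁ (toggle-other X Ti i≢j))) λ ()

  toggle-matching : ∀ {X j} → Matching X → Matching (toggle X j)
  toggle-matching {X} {j} X-matching {i} {k} Ti Tk i≢k i~k with i ≟ j | k ≟ j
  ... | yes refl | yes refl = i≢k refl
  ... | yes refl | no k≢j = proj₂ (toggle-other X Tk k≢j) i~k
  ... | no i≢j | yes refl = proj₂ (toggle-other X Ti i≢j) (touch-sym i~k)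
  ... | no i≢j | no k≢j = X-matching (proj₁ (toggle-other X Ti i≢j)) (proj₁ (toggle-other X Tk k≢j)) i≢k i~k

  toggle-changes : ∀ X j → lookup X j ≢ lookup (toggle X j) j
  toggle-changes X j = subst (lookup X j ≢_) (sym (toggle-self X j)) (not-¬ refl)

  -- Every edge where M and toggle M j differ meets j and lies on the other side of it.
  toggle-adjacent : ∀ {M} j → Matching M → SkelAdj G M (toggle M j)
  toggle-adjacent {M} j M-matching = connected⇒adjacent (toggle-changes M j) linked
    where
      open Exposing M (toggle M j)
      linked : ∀ d → lookup M d ≢ lookup (toggle M j) d → Linked j d
      linked d Md≢Td with d ≟ j | touch? j d
      ... | yes refl | _ = ε
      ... | no _ | no j≁d = contradiction (sym (toggle-far M j≁d)) Md≢Td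
      ... | no d≢j | yes j~d = bwd ((Md , Td) , (Tj , Mj) , touch-sym j~d) ◅ ε
        where
          Td : lookup (toggle M j) d ≡ false
          Td = toggle-meeting M d≢j j~d
          Md : lookup M d ≡ true
          Md = trans (¬-not Md≢Td) (cong not Td)
          Mj : lookup M j ≡ false
          Mj = ¬-not λ Mj → M-matching Md Mj d≢j (touch-sym j~d)
          Tj : lookup (toggle M j) j ≡ true
          Tj = trans (toggle-self M j) (cong not Mj)

  toggle-injective : ∀ {M j k} → Matching M → toggle M j ≡ toggle M k → j ≡ k
  toggle-injective {M} {j} {k} M-matching Tj≡Tk = decidable-stable (j ≟ k) λ j≢k → meet-or-not j≢k (touch? k j)
    where
      added : ∀ {a b} → toggle M a ≡ toggle M b → lookup M a ≡ false → a ≡ b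
      added {a} Ta≡Tb Ma = toggle-new M (trans (cong (λ Z → lookup Z a) (sym Ta≡Tb)) (trans (toggle-self M a) (cong not Ma))) Ma
      both-in-M : j ≢ k → lookup M j ≡ true × lookup M k ≡ true
      both-in-M j≢k = ¬-not (j≢k ∘ added Tj≡Tk) , ¬-not (j≢k ∘ sym ∘ added (sym Tj≡Tk))
      meet-or-not : j ≢ k → Dec (Touch k j) → ⊥
      meet-or-not j≢k (yes k~j) = M-matching (proj₁ (both-in-M j≢k)) (proj₂ (both-in-M j≢k)) j≢k (touch-sym k~j)
      meet-or-not j≢k (no k≁j) = contradiction
        (trans (sym (trans (toggle-far M k≁j) Mj))
               (trans (cong (λ Z → lookup Z j) (sym Tj≡Tk)) (trans (toggle-self M j) (cong not Mj))))
        λ ()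
        where
          Mj : lookup M j ≡ true
          Mj = proj₁ (both-in-M j≢k)

  -- Compare N with the recombination taking N on the edges meeting j and M elsewhere.
  neighbour-is-toggle : ∀ {M N} j → Matching M → Matching N → SkelAdj G M N →
    lookup N j ≡ not (lookup M j) →
    (∀ {i} → i ≢ j → Touch j i → lookup N i ≡ false) →
    (∀ {i k} → lookup M i ≡ true → Touch j i → lookup N k ≡ true → ¬ Touch j k → ¬ Touch i k) →
    N ≡ toggle M j
  neighbour-is-toggle {M} {N} j M-matching N-matching adj Nj N-avoids crossing =
    [ (λ mix≡M → contradiction (trans (sym mix≡toggle) mix≡M) (toggle-changes M j ∘ sym ∘ cong (λ Z → lookup Z j)))
    , (λ mix≡N → trans (sym mix≡N) mix≡toggle)
    ]′ (adjacent-recombination D adj mix-matching (subst Matching (sym mix≡toggle) (toggle-matching {M} M-matching)))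
    where
      D : Fin m → Bool
      D i = does (touch? j i)

      mix≡toggle : mix D N M ≡ toggle M j
      mix≡toggle = lookup-extensional pointwise
        where
          pointwise : ∀ i → lookup (mix D N M) i ≡ lookup (toggle M j) i
          pointwise i rewrite lookup-mix D N M i with i ≟ j | touch? j i
          ... | yes refl | yes _ = trans Nj (sym (toggle-self M j))
          ... | yes refl | no j≁j = contradiction (touch-refl j) j≁j
          ... | no i≢j | yes j~i = trans (N-avoids i≢j j~i) (sym (toggle-meeting M i≢j j~i))
          ... | no _ | no j≁i = sym (toggle-far M j≁i)

      member : ∀ i → lookup (mix D M N) i ≡ true → (lookup M i ≡ true × Touch j i) ⊎ (lookup N i ≡ true × ¬ Touch j i)
      member i Pi = by-cases (touch? j i) (trans (sym (lookup-mix D M N i)) Pi)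
        where
          by-cases : (d : Dec (Touch j i)) → (if does d then lookup M i else lookup N i) ≡ true →
                     (lookup M i ≡ true × Touch j i) ⊎ (lookup N i ≡ true × ¬ Touch j i)
          by-cases (yes j~i) Mi = inj₁ (Mi , j~i)
          by-cases (no j≁i) Ni = inj₂ (Ni , j≁i)

      mix-matching : Matching (mix D M N)
      mix-matching {i} {k} Pi Pk i≢k i~k with member i Pi | member k Pk
      ... | inj₁ (Mi , _) | inj₁ (Mk , _) = M-matching Mi Mk i≢k i~k
      ... | inj₂ (Ni , _) | inj₂ (Nk , _) = N-matching Ni Nk i≢k i~k
      ... | inj₁ (Mi , j~i) | inj₂ (Nk , j≁k) = crossing Mi j~i Nk j≁k i~k
      ... | inj₂ (Ni , j≁i) | inj₁ (Mk , j~k) = crossing Mk j~k Ni j≁i (touch-sym i~k)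

  removed-edge-neighbour : ∀ {M N} → Matching M → Matching N → SkelAdj G M N →
                           (∀ {i} → lookup N i ≡ true → lookup M i ≡ true) → ∃ λ j → N ≡ toggle M j
  removed-edge-neighbour {M} {N} M-matching N-matching adj N⊆M
    with any? (λ j → (lookup M j Bool.≟ true) ×-dec (lookup N j Bool.≟ false))
  ... | yes (j , Mj , Nj) = j , neighbour-is-toggle j M-matching N-matching adj (trans Nj (cong not (sym Mj)))
      (λ i≢j j~i → ¬-not λ Ni → M-matching (N⊆M Ni) Mj i≢j (touch-sym j~i))
      (λ Mi j~i Nk j≁k → M-matching Mi (N⊆M Nk) (λ { refl → j≁k j~i }))
  ... | no none-removed = contradiction (lookup-extensional λ i → agree i (lookup N i) refl) (proj₁ adj)
    where
      agree : ∀ i b → lookup N i ≡ b → lookup M i ≡ b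
      agree i true Ni = N⊆M Ni
      agree i false Ni = ¬-not λ Mi → none-removed (i , Mi , Ni)

  neighbours-are-toggles : ∀ {M N} → Matching M → (∀ e → lookup M e ≡ true → CliqueNeighbourhood e) →
                           Matching N → SkelAdj G M N → ∃ λ j → N ≡ toggle M j
  neighbours-are-toggles {M} {N} M-matching cliques N-matching adj
    with any? (λ j → (lookup N j Bool.≟ true) ×-dec (lookup M j Bool.≟ false))
  ... | yes (j , Nj , Mj) = j , neighbour-is-toggle j M-matching N-matching adj (trans Nj (cong not (sym Mj)))
      (λ i≢j j~i → ¬-not λ Ni → N-matching Ni Nj i≢j (touch-sym j~i))
      (λ {i} Mi j~i Nk j≁k i~k → j≁k (cliques i Mi j~i (touch-sym i~k)))
  ... | no none-added = removed-edge-neighbour M-matching N-matching adj λ {i} Ni →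
      ¬-not λ Mi → none-added (i , Ni , Mi)

  -- Toggling two disjoint edges f, g that meet e ∈ M gives a neighbour linked through e.
  module DoubleToggle {M e f g} (M-matching : Matching M) (Me : lookup M e ≡ true)
                      (f~e : Touch f e) (g~e : Touch g e) (f≁g : ¬ Touch f g) where

    N : Subset m
    N = toggle (toggle M f) g

    open Exposing M N

    f≢e : f ≢ e
    f≢e refl = f≁g (touch-sym g~e)

    g≢e : g ≢ e
    g≢e refl = f≁g f~e

    f≢g : f ≢ g
    f≢g refl = f≁g (touch-refl f)

    Mf : lookup M f ≡ false
    Mf = ¬-not λ Mf → M-matching Mf Me f≢e f~e

    Mg : lookup M g ≡ false
    Mg = ¬-not λ Mg → M-matching Mg Me g≢e g~e

    Nf : lookup N f ≡ true
    Nf = trans (toggle-far (toggle M f) (f≁g ∘ touch-sym)) (trans (toggle-self M f) (cong not Mf))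

    Ng : lookup N g ≡ true
    Ng = trans (toggle-self (toggle M f) g) (cong not (trans (toggle-far M f≁g) Mg))

    Ne : lookup N e ≡ false
    Ne = toggle-meeting (toggle M f) (g≢e ∘ sym) g~e

    e-f : Alternating e f
    e-f = (Me , Ne) , (Nf , Mf) , touch-sym f~e

    e-g : Alternating e g
    e-g = (Me , Ne) , (Ng , Mg) , touch-sym g~e

    N-matching : Matching N
    N-matching = toggle-matching {toggle M f} (toggle-matching {M} M-matching)

    linked : ∀ d → lookup M d ≢ lookup N d → Linked e d
    linked d Md≢Nd with d ≟ f | d ≟ g | touch? g d | touch? f d
    ... | yes refl | _ | _ | _ = fwd e-f ◅ ε
    ... | no _ | yes refl | _ | _ = fwd e-g ◅ ε
    ... | no _ | no d≢g | yes g~d | _ = fwd e-g ◅ bwd ((Md , Nd) , (Ng , Mg) , touch-sym g~d) ◅ ε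
      where
        Nd : lookup N d ≡ false
        Nd = toggle-meeting (toggle M f) d≢g g~d
        Md : lookup M d ≡ true
        Md = trans (¬-not Md≢Nd) (cong not Nd)
    ... | no d≢f | no _ | no g≁d | yes f~d = fwd e-f ◅ bwd ((Md , Nd) , (Nf , Mf) , touch-sym f~d) ◅ ε
      where
        Nd : lookup N d ≡ false
        Nd = trans (toggle-far (toggle M f) g≁d) (toggle-meeting M d≢f f~d)
        Md : lookup M d ≡ true
        Md = trans (¬-not Md≢Nd) (cong not Nd)
    ... | no _ | no _ | no g≁d | no f≁d = contradiction (sym (trans (toggle-far (toggle M f) g≁d) (toggle-far M f≁d))) Md≢Nd

    N-adjacent : SkelAdj G M N
    N-adjacent = connected⇒adjacent (λ Me≡Ne → contradiction (trans (sym Me) (trans Me≡Ne Ne)) λ ()) linked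

    N-not-a-toggle : ∀ j → N ≢ toggle M j
    N-not-a-toggle j N≡Tj = f≢g (trans (toggle-new M (trans (cong (λ Z → lookup Z f) (sym N≡Tj)) Nf) Mf)
                                     (sym (toggle-new M (trans (cong (λ Z → lookup Z g) (sym N≡Tj)) Ng) Mg)))

  more-than-m-neighbours : ∀ {M N} → Matching M → Matching N → SkelAdj G M N → (∀ j → N ≢ toggle M j) →
                           ¬ HasSkelDegree G M m
  more-than-m-neighbours {M} {N} M-matching N-matching adj new (Ns , length≡m , _ , _ , complete) =
    ℕP.<-irrefl (sym length≡m) (subst (ℕ._≤ length Ns) (cong suc (ListP.length-tabulate (toggle M)))
      (unique-⊆⇒length-≤ (All.tabulate⁺ new ∷ Unique.tabulate⁺ (toggle-injective {M} M-matching)) ⊆Ns))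
    where
      ⊆Ns : N ∷ List.tabulate (toggle M) ⊆ Ns
      ⊆Ns (here refl) = complete N (Matching⇒IsMatching N-matching) adj
      ⊆Ns (there L∈) with ∈-tabulate⁻ L∈
      ... | j , refl = complete (toggle M j) (Matching⇒IsMatching (toggle-matching {M} M-matching)) (toggle-adjacent j M-matching)

  cliques⇒skeleton-degree : ∀ {M} → Matching M → (∀ e → lookup M e ≡ true → CliqueNeighbourhood e) →
                            HasSkelDegree G M m
  cliques⇒skeleton-degree {M} M-matching cliques =
      List.tabulate (toggle M)
    , ListP.length-tabulate (toggle M)
    , Unique.tabulate⁺ (toggle-injective {M} M-matching)
    , All.tabulate⁺ (λ j → Matching⇒IsMatching (toggle-matching {M} M-matching) , toggle-adjacent j M-matching)
    , λ N N-matching adj → let (j , N≡Tj) = neighbours-are-toggles M-matching cliques (IsMatching⇒Matching N-matching) adj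
                           in subst (_∈ₗ List.tabulate (toggle M)) (sym N≡Tj) (∈-tabulate⁺ j)

  skeleton-degree⇒cliques : ∀ {M} → Matching M → HasSkelDegree G M m →
                            ∀ e → lookup M e ≡ true → CliqueNeighbourhood e
  skeleton-degree⇒cliques {M} M-matching degree e Me with clique-or-witness e
  ... | inj₁ clique = clique
  ... | inj₂ (f , g , f~e , g~e , f≁g) = contradiction degree (more-than-m-neighbours M-matching N-matching N-adjacent N-not-a-toggle)
    where open DoubleToggle {M} M-matching Me f~e g~e f≁g


theorem4p2 : (G : Graph) (M : Subset (Graph.m G)) → IsMatching G M →
    (∃ λ i → i ∈ M) →
    (HasSkelDegree G M (Graph.m G) ⇔ (∀ i → i ∈ M → Bond G i ⊎ Pendant G i))
theorem4p2 G M M-matching _ = mk⇔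
    (λ degree i i∈M → clique⇒bond-or-pendant G (skeleton-degree⇒cliques G matching degree i (VecP.[]=⇒lookup i∈M)))
    (λ bond-or-pendant → cliques⇒skeleton-degree G matching λ e Me →
      bond-or-pendant⇒clique G (bond-or-pendant e (VecP.lookup⇒[]= e M Me)))
  where
    matching : Matching G M
    matching = IsMatching⇒Matching G M-matching
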